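{- Let $n\in\mathbb{N}$ be even, let $\ell\ge 2$, and let $G$ be an $N$-AW graph on $n$ vertices with $|E(\overline{G})|=\frac{n}{2}+t$, where $t\ge 1$. Then $\Delta(\overline{G})\le t+1$, where $\Delta(\overline{G})$ is the maximum degree of $\overline{G}$.
   Context: All graphs are finite and simple; labels lie in $\mathbb{Z}_\ell$. In the neighborhood Lights Out game on a graph $G$, each vertex carries a label in $\mathbb{Z}_\ell$; toggling a vertex $v$ adds $1$ (mod $\ell$) to the label of every vertex of the closed neighborhood $N[v]$; the game is won when all labels are $0$. $G$ is $N$-AW if the game can be won from every initial labeling. $\overline{G}$ is the complement of $G$. -}

module Defs where

open import Data.Nat using (ℕ; zero; suc; _+_; _*_; _%_; _<_; _≤_; NonZero)
open import Data.Fin using (Fin; toℕ; zero; suc; _≟_; _<?_)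
open import Data.Bool using (Bool; true; false; not; _∨_; _∧_; if_then_else_)
open import Data.Nat.Divisibility using (_∣_)
open import Data.Product using (Σ; _×_; ∃)
open import Relation.Binary.PropositionalEquality using (_≡_)
open import Relation.Nullary using (¬_)
open import Relation.Nullary.Decidable using (⌊_⌋)

Σ[<_]_ : (n : ℕ) → (Fin n → ℕ) → ℕ
Σ[< zero ] f = 0
Σ[< suc n ] f = f zero + Σ[< n ] (λ i → f (suc i))

count : (n : ℕ) → (Fin n → Bool) → ℕ
count n p = Σ[< n ] (λ i → if p i then 1 else 0)

record Graph (n : ℕ) : Set where
  field
    adj   : Fin n → Fin n → Bool
    sym   : ∀ u v → adj u v ≡ adj v u
    irrefl : ∀ v → adj v v ≡ false
open Graph public

inClosedNbhd : ∀ {n} → Graph n → Fin n → Fin n → Bool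
inClosedNbhd G v u = ⌊ u ≟ v ⌋ ∨ adj G v u

coAdj : ∀ {n} → Graph n → Fin n → Fin n → Bool
coAdj G u v = not ⌊ u ≟ v ⌋ ∧ not (adj G u v)

coDegree : ∀ {n} → Graph n → Fin n → ℕ
coDegree {n} G v = count n (coAdj G v)

coEdges : ∀ {n} → Graph n → ℕ
coEdges {n} G = Σ[< n ] (λ u → count n (λ v → ⌊ u <? v ⌋ ∧ coAdj G u v))

-- Neighborhood Lights Out over ℤ_ℓ.
-- Toggling vertex v (x v times) adds x v to every label in N[v].
Winnable : ∀ {n} (ℓ : ℕ) → Graph n → (Fin n → Fin ℓ) → Set
Winnable {n} ℓ G c =
  Σ (Fin n → ℕ) λ x → ∀ u →
    ℓ ∣ (toℕ (c u) + Σ[< n ] (λ v → if inClosedNbhd G v u then x v else 0))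

NAW : ∀ {n} (ℓ : ℕ) → Graph n → Set
NAW {n} ℓ G = (c : Fin n → Fin ℓ) → Winnable ℓ G c

MaxCoDegree≤ : ∀ {n} → Graph n → ℕ → Set
MaxCoDegree≤ {n} G k = ∀ v → coDegree G v ≤ k

-- In an always-winnable graph no two distinct vertices u, w have the same
-- closed neighbourhood: for the labeling that is 1 at u and 0 elsewhere, every
-- toggle pattern adds the same amount at u and at w, so it cannot clear both
-- modulo ℓ ≥ 2. In the complement these are vertices with equal open
-- neighbourhoods, so the complement has at most one isolated vertex and at
-- most one leaf hanging at any given vertex v. Let d be the complement degree
-- of v. Every vertex other than v then has degree at least 1, and at least 2
-- if it is adjacent to v, up to these two exceptions; summing degrees gives
-- n + 2t = 2|E(Ḡ)| ≥ d + 2d + (n - 1 - d) - 2 = n + 2d - 3, so d ≤ t + 1.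
module Submission where

open import Defs
open import Data.Nat using (ℕ; _+_; _*_; _≤_)
open import Data.Nat.Divisibility using (_∣_)
open import Relation.Binary.PropositionalEquality using (_≡_)

open import Data.Bool using (Bool; true; false; not; _∧_; if_then_else_)
open import Data.Fin using (Fin; zero; suc; toℕ; _≟_; _<?_)
open import Data.Fin.Properties using (<-cmp; <-irrefl; <-asym; suc-injective)
open import Data.Nat as ℕ using (zero; suc; pred; z≤n; s≤s; _<_)
open import Data.Nat.Divisibility using (∣m+n∣m⇒∣n; ∣1⇒≡1)
open import Data.Nat.Properties
  using (+-assoc; +-comm; +-mono-≤; ≤-refl; ≤-reflexive; ≤-trans; m≤m+n; m≤n+m;
         +-identityʳ; +-cancelˡ-≤; ≮⇒≥; 1+n≰n; +-commutativeSemigroup; +-0-commutativeMonoid;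
         module ≤-Reasoning)
open import Algebra.Properties.CommutativeSemigroup +-commutativeSemigroup
  using (xy∙z≈xz∙y)
open import Algebra.Properties.CommutativeMonoid.Sum +-0-commutativeMonoid
  using (sum; ∑-distrib-+; ∑-comm; sum-replicate-zero)
open import Data.Nat.Tactic.RingSolver using (solve-∀)
open import Data.Product using (proj₁; proj₂)
open import Function using (_∘_; flip)
open import Relation.Binary using (tri<; tri≈; tri>)
open import Relation.Binary.PropositionalEquality as ≡
  using (refl; trans; cong; cong₂; subst; module ≡-Reasoning)
open import Relation.Nullary using (Dec; yes; no; ¬_; contradiction)
open import Relation.Nullary.Decidable using (⌊_⌋; isYes≗does; dec-true; dec-false)

𝟙 : Bool → ℕ
𝟙 b = if b then 1 else 0

𝟙≤0⇒false : ∀ {b} → 𝟙 b ≤ 0 → b ≡ false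
𝟙≤0⇒false {false} _ = refl

true⇒1≤𝟙 : ∀ {b} → b ≡ true → 1 ≤ 𝟙 b
true⇒1≤𝟙 refl = ≤-refl

⌊⌋-yes : ∀ {a} {A : Set a} (a? : Dec A) → A → ⌊ a? ⌋ ≡ true
⌊⌋-yes a? a = trans (isYes≗does a?) (dec-true a? a)

⌊⌋-no : ∀ {a} {A : Set a} (a? : Dec A) → ¬ A → ⌊ a? ⌋ ≡ false
⌊⌋-no a? ¬a = trans (isYes≗does a?) (dec-false a? ¬a)

⌊⌋-true⇒ : ∀ {a} {A : Set a} (a? : Dec A) → ⌊ a? ⌋ ≡ true → A
⌊⌋-true⇒ (yes a) _ = a

⌊≟⌋-sym : ∀ {n} (u w : Fin n) → ⌊ u ≟ w ⌋ ≡ ⌊ w ≟ u ⌋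
⌊≟⌋-sym u w with u ≟ w
... | yes refl = ≡.sym (⌊⌋-yes (u ≟ u) refl)
... | no u≢w   = ≡.sym (⌊⌋-no (w ≟ u) (u≢w ∘ ≡.sym))

Σ≡sum : ∀ n (f : Fin n → ℕ) → Σ[< n ] f ≡ sum f
Σ≡sum zero    f = refl
Σ≡sum (suc n) f = cong (f zero +_) (Σ≡sum n (f ∘ suc))

Σ-cong : ∀ n {f g : Fin n → ℕ} → (∀ i → f i ≡ g i) → Σ[< n ] f ≡ Σ[< n ] g
Σ-cong zero    f≗g = refl
Σ-cong (suc n) f≗g = cong₂ _+_ (f≗g zero) (Σ-cong n (f≗g ∘ suc))

Σ-mono-≤ : ∀ n {f g : Fin n → ℕ} → (∀ i → f i ≤ g i) → Σ[< n ] f ≤ Σ[< n ] g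
Σ-mono-≤ zero    f≤g = z≤n
Σ-mono-≤ (suc n) f≤g = +-mono-≤ (f≤g zero) (Σ-mono-≤ n (f≤g ∘ suc))

Σ-mono-≤-slack : ∀ n {f g : Fin n → ℕ} {k} v → (∀ i → f i ≤ g i) →
                 f v + k ≤ g v → Σ[< n ] f + k ≤ Σ[< n ] g
Σ-mono-≤-slack (suc n) {f} {g} {k} zero f≤g slack = begin
  f zero + Σ[< n ] (f ∘ suc) + k  ≡⟨ xy∙z≈xz∙y (f zero) _ k ⟩
  f zero + k + Σ[< n ] (f ∘ suc)  ≤⟨ +-mono-≤ slack (Σ-mono-≤ n (f≤g ∘ suc)) ⟩
  g zero + Σ[< n ] (g ∘ suc)      ∎
  where open ≤-Reasoning
Σ-mono-≤-slack (suc n) {f} {g} {k} (suc v) f≤g slack = begin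
  f zero + Σ[< n ] (f ∘ suc) + k    ≡⟨ +-assoc (f zero) _ k ⟩
  f zero + (Σ[< n ] (f ∘ suc) + k)  ≤⟨ +-mono-≤ (f≤g zero) (Σ-mono-≤-slack n v (f≤g ∘ suc) slack) ⟩
  g zero + Σ[< n ] (g ∘ suc)        ∎
  where open ≤-Reasoning

≤-Σ : ∀ n (f : Fin n → ℕ) i → f i ≤ Σ[< n ] f
≤-Σ (suc n) f zero    = m≤m+n (f zero) _
≤-Σ (suc n) f (suc i) = ≤-trans (≤-Σ n (f ∘ suc) i) (m≤n+m _ (f zero))

Σ-zero : ∀ n → Σ[< n ] (λ _ → 0) ≡ 0
Σ-zero n = trans (Σ≡sum n _) (sum-replicate-zero n)

Σ-one : ∀ n → Σ[< n ] (λ _ → 1) ≡ n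
Σ-one zero    = refl
Σ-one (suc n) = cong suc (Σ-one n)

Σ-distrib-+ : ∀ n (f g : Fin n → ℕ) →
              Σ[< n ] (λ i → f i + g i) ≡ Σ[< n ] f + Σ[< n ] g
Σ-distrib-+ n f g = begin
  Σ[< n ] (λ i → f i + g i)  ≡⟨ Σ≡sum n _ ⟩
  sum (λ i → f i + g i)      ≡⟨ ∑-distrib-+ f g ⟩
  sum f + sum g              ≡⟨ ≡.sym (cong₂ _+_ (Σ≡sum n f) (Σ≡sum n g)) ⟩
  Σ[< n ] f + Σ[< n ] g      ∎
  where open ≡-Reasoning

Σ-comm : ∀ m n (f : Fin m → Fin n → ℕ) →
         Σ[< m ] (λ i → Σ[< n ] (f i)) ≡ Σ[< n ] (λ j → Σ[< m ] (λ i → f i j))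
Σ-comm m n f = begin
  Σ[< m ] (λ i → Σ[< n ] (f i))            ≡⟨ Σ²≡sum² m n f ⟩
  sum (λ i → sum (f i))                    ≡⟨ ∑-comm f ⟩
  sum (λ j → sum (λ i → f i j))            ≡⟨ ≡.sym (Σ²≡sum² n m (flip f)) ⟩
  Σ[< n ] (λ j → Σ[< m ] (λ i → f i j))    ∎
  where
  open ≡-Reasoning
  Σ²≡sum² : ∀ m n (f : Fin m → Fin n → ℕ) →
            Σ[< m ] (λ i → Σ[< n ] (f i)) ≡ sum (λ i → sum (f i))
  Σ²≡sum² m n f = trans (Σ-cong m (λ i → Σ≡sum n (f i))) (Σ≡sum m _)

count≡0⇒false : ∀ n {p : Fin n → Bool} → count n p ≡ 0 → ∀ i → p i ≡ false
count≡0⇒false n {p} count≡0 i = 𝟙≤0⇒false (subst (𝟙 (p i) ≤_) count≡0 (≤-Σ n (𝟙 ∘ p) i))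

count≤1⇒unique : ∀ n {p : Fin n → Bool} → count n p ≤ 1 →
                 ∀ {a b} → p a ≡ true → p b ≡ true → a ≡ b
count≤1⇒unique (suc n) {p} count≤1 = unique
  where
  not-zero-and-suc : ∀ {j} → p zero ≡ true → p (suc j) ≡ true → zero ≡ suc j
  not-zero-and-suc {j} p0 pj = contradiction
    (≤-trans (+-mono-≤ (true⇒1≤𝟙 p0) (≤-trans (true⇒1≤𝟙 pj) (≤-Σ n (𝟙 ∘ p ∘ suc) j))) count≤1)
    1+n≰n
  unique : ∀ {a b} → p a ≡ true → p b ≡ true → a ≡ b
  unique {zero}  {zero}  _  _  = refl
  unique {zero}  {suc b} pa pb = not-zero-and-suc pa pb
  unique {suc a} {zero}  pa pb = ≡.sym (not-zero-and-suc pb pa)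
  unique {suc a} {suc b} pa pb =
    cong suc (count≤1⇒unique n (≤-trans (m≤n+m _ (𝟙 (p zero))) count≤1) pa pb)

count≤1-true⇒≡⌊≟⌋ : ∀ n {p : Fin n → Bool} → count n p ≤ 1 →
                    ∀ {a} → p a ≡ true → ∀ i → p i ≡ ⌊ i ≟ a ⌋
count≤1-true⇒≡⌊≟⌋ n {p} count≤1 {a} pa i with i ≟ a | p i in pi
... | yes refl | _     = trans (≡.sym pi) pa
... | no  _    | false = refl
... | no  i≢a  | true  = contradiction (count≤1⇒unique n count≤1 pi pa) i≢a

unique⇒count≤1 : ∀ n {p : Fin n → Bool} →
                 (∀ {a b} → p a ≡ true → p b ≡ true → a ≡ b) → count n p ≤ 1
unique⇒count≤1 zero    _      = z≤n
unique⇒count≤1 (suc n) {p} unique with p zero in p0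
... | false = unique⇒count≤1 n (λ pa pb → suc-injective (unique pa pb))
... | true  = s≤s (≤-reflexive (trans (Σ-cong n tail-zero) (Σ-zero n)))
  where
  tail-zero : ∀ i → 𝟙 (p (suc i)) ≡ 0
  tail-zero i with p (suc i) in pi
  ... | false = refl
  ... | true with () ← unique p0 pi

coAdj-sym : ∀ {n} (G : Graph n) u w → coAdj G u w ≡ coAdj G w u
coAdj-sym G u w rewrite ⌊≟⌋-sym u w | Graph.sym G u w = refl

coAdj-irrefl : ∀ {n} (G : Graph n) u → coAdj G u u ≡ false
coAdj-irrefl G u rewrite ⌊⌋-yes (u ≟ u) refl = refl

inClosedNbhd≡not-coAdj : ∀ {n} (G : Graph n) v u → inClosedNbhd G v u ≡ not (coAdj G u v)
inClosedNbhd≡not-coAdj G v u rewrite Graph.sym G v u with ⌊ u ≟ v ⌋ | adj G u v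
... | true  | _     = refl
... | false | true  = refl
... | false | false = refl

Σ-coDegree≡2*coEdges : ∀ {n} (G : Graph n) → Σ[< n ] (coDegree G) ≡ 2 * coEdges G
Σ-coDegree≡2*coEdges {n} G = begin
  Σ[< n ] (λ u → Σ[< n ] (λ w → 𝟙 (coAdj G u w)))
    ≡⟨ Σ-cong n (λ u → Σ-cong n (split u)) ⟩
  Σ[< n ] (λ u → Σ[< n ] (λ w → ordered u w + ordered w u))
    ≡⟨ Σ-cong n (λ u → Σ-distrib-+ n (ordered u) (flip ordered u)) ⟩
  Σ[< n ] (λ u → Σ[< n ] (ordered u) + Σ[< n ] (flip ordered u))
    ≡⟨ Σ-distrib-+ n _ _ ⟩
  coEdges G + Σ[< n ] (λ u → Σ[< n ] (flip ordered u))
    ≡⟨ cong (coEdges G +_) (≡.sym (Σ-comm n n ordered)) ⟩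
  coEdges G + coEdges G
    ≡⟨ cong (coEdges G +_) (≡.sym (+-identityʳ (coEdges G))) ⟩
  2 * coEdges G ∎
  where
  open ≡-Reasoning
  ordered : Fin n → Fin n → ℕ
  ordered u w = 𝟙 (⌊ u <? w ⌋ ∧ coAdj G u w)
  split : ∀ u w → 𝟙 (coAdj G u w) ≡ ordered u w + ordered w u
  split u w with <-cmp u w
  ... | tri< u<w _ _ rewrite ⌊⌋-yes (u <? w) u<w | ⌊⌋-no (w <? u) (<-asym u<w) =
    ≡.sym (+-identityʳ _)
  ... | tri≈ _ refl _ rewrite coAdj-irrefl G u | ⌊⌋-no (u <? u) (<-irrefl refl) = refl
  ... | tri> _ _ w<u rewrite ⌊⌋-no (u <? w) (<-asym w<u) | ⌊⌋-yes (w <? u) w<u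
                           | coAdj-sym G u w = refl

closedTwins⇒≡ : ∀ {n ℓ} (G : Graph n) → NAW ℓ G → 2 ≤ ℓ → ∀ {u w} →
                (∀ v → inClosedNbhd G v u ≡ inClosedNbhd G v w) → u ≡ w
closedTwins⇒≡ {n} {ℓ} G naw (s≤s (s≤s _)) {u} {w} twins with u ≟ w
... | yes u≡w = u≡w
... | no  u≢w = contradiction (∣1⇒≡1 ℓ∣1) λ ()
  where
  unitAt-u : Fin n → Fin ℓ
  unitAt-u z = if ⌊ z ≟ u ⌋ then suc zero else zero
  x : Fin n → ℕ
  x = proj₁ (naw unitAt-u)
  pressed : Fin n → ℕ
  pressed z = Σ[< n ] (λ v → if inClosedNbhd G v z then x v else 0)
  cleared : ∀ z → ℓ ∣ toℕ (unitAt-u z) + pressed z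
  cleared = proj₂ (naw unitAt-u)
  pressed-u≡pressed-w : pressed u ≡ pressed w
  pressed-u≡pressed-w = Σ-cong n (λ v → cong (λ b → if b then x v else 0) (twins v))
  ℓ∣pressed-u+1 : ℓ ∣ pressed u + 1
  ℓ∣pressed-u+1 = subst (ℓ ∣_) (+-comm 1 (pressed u))
    (subst (λ b → ℓ ∣ toℕ (if b then suc zero else zero) + pressed u)
           (⌊⌋-yes (u ≟ u) refl) (cleared u))
  ℓ∣pressed-u : ℓ ∣ pressed u
  ℓ∣pressed-u = subst (ℓ ∣_) (≡.sym pressed-u≡pressed-w)
    (subst (λ b → ℓ ∣ toℕ (if b then suc zero else zero) + pressed w)
           (⌊⌋-no (w ≟ u) (u≢w ∘ ≡.sym)) (cleared w))
  ℓ∣1 : ℓ ∣ 1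
  ℓ∣1 = ∣m+n∣m⇒∣n ℓ∣pressed-u+1 ℓ∣pressed-u

coTwins⇒≡ : ∀ {n ℓ} (G : Graph n) → NAW ℓ G → 2 ≤ ℓ → ∀ {u w} →
            (∀ x → coAdj G u x ≡ coAdj G w x) → u ≡ w
coTwins⇒≡ G naw 2≤ℓ {u} {w} twins = closedTwins⇒≡ G naw 2≤ℓ λ v → begin
  inClosedNbhd G v u  ≡⟨ inClosedNbhd≡not-coAdj G v u ⟩
  not (coAdj G u v)   ≡⟨ cong not (twins v) ⟩
  not (coAdj G w v)   ≡⟨ ≡.sym (inClosedNbhd≡not-coAdj G v w) ⟩
  inClosedNbhd G v w  ∎
  where open ≡-Reasoning

coIsolated : ∀ {n} → Graph n → Fin n → Bool
coIsolated G u = ⌊ coDegree G u ℕ.≟ 0 ⌋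

coLeafAt : ∀ {n} → Graph n → Fin n → Fin n → Bool
coLeafAt G v u = coAdj G v u ∧ ⌊ coDegree G u ℕ.≟ 1 ⌋

count-coIsolated≤1 : ∀ {n ℓ} (G : Graph n) → NAW ℓ G → 2 ≤ ℓ → count n (coIsolated G) ≤ 1
count-coIsolated≤1 {n} G naw 2≤ℓ = unique⇒count≤1 n λ isolated-u isolated-w →
  coTwins⇒≡ G naw 2≤ℓ λ x →
    trans (no-coNeighbour isolated-u x) (≡.sym (no-coNeighbour isolated-w x))
  where
  no-coNeighbour : ∀ {u} → coIsolated G u ≡ true → ∀ x → coAdj G u x ≡ false
  no-coNeighbour {u} isolated = count≡0⇒false n (⌊⌋-true⇒ (coDegree G u ℕ.≟ 0) isolated)

count-coLeafAt≤1 : ∀ {n ℓ} (G : Graph n) → NAW ℓ G → 2 ≤ ℓ → ∀ v → count n (coLeafAt G v) ≤ 1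
count-coLeafAt≤1 {n} G naw 2≤ℓ v = unique⇒count≤1 n λ leaf-u leaf-w →
  coTwins⇒≡ G naw 2≤ℓ λ x → trans (only-coNeighbour leaf-u x) (≡.sym (only-coNeighbour leaf-w x))
  where
  only-coNeighbour : ∀ {u} → coLeafAt G v u ≡ true → ∀ x → coAdj G u x ≡ ⌊ x ≟ v ⌋
  only-coNeighbour {u} leaf with coAdj G v u in vu | coDegree G u ℕ.≟ 1 in deg
  ... | true | yes deg≡1 = count≤1-true⇒≡⌊≟⌋ n (≤-reflexive deg≡1) (trans (coAdj-sym G u v) vu)

-- For a complement vertex of degree d, c records adjacency to the fixed vertex v;
-- the correction terms pay for the isolated vertex and the leaf at v, which fall short.
weight : ℕ → Bool → ℕ
weight d c = d + 𝟙 ⌊ d ℕ.≟ 0 ⌋ + 𝟙 (c ∧ ⌊ d ℕ.≟ 1 ⌋)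

suc-𝟙≤weight : ∀ d c → 𝟙 c ≤ d → suc (𝟙 c) ≤ weight d c
suc-𝟙≤weight zero          false _ = s≤s z≤n
suc-𝟙≤weight (suc d)       false _ = s≤s z≤n
suc-𝟙≤weight (suc zero)    true  _ = s≤s (s≤s z≤n)
suc-𝟙≤weight (suc (suc d)) true  _ = s≤s (s≤s z≤n)

suc-pred≤weight : ∀ d c → suc (pred d) ≤ weight d c
suc-pred≤weight zero    c = s≤s z≤n
suc-pred≤weight (suc d) c = ≤-trans (m≤m+n (suc d) _) (m≤m+n _ _)

Σ-weight : ∀ {n} (G : Graph n) v →
           Σ[< n ] (λ u → weight (coDegree G u) (coAdj G v u))
             ≡ 2 * coEdges G + count n (coIsolated G) + count n (coLeafAt G v)
Σ-weight {n} G v = begin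
  Σ[< n ] (λ u → D u + I u + L u)         ≡⟨ Σ-distrib-+ n _ L ⟩
  Σ[< n ] (λ u → D u + I u) + Σ[< n ] L   ≡⟨ cong (_+ Σ[< n ] L) (Σ-distrib-+ n D I) ⟩
  Σ[< n ] D + Σ[< n ] I + Σ[< n ] L       ≡⟨ cong (λ s → s + Σ[< n ] I + Σ[< n ] L)
                                                  (Σ-coDegree≡2*coEdges G) ⟩
  2 * coEdges G + Σ[< n ] I + Σ[< n ] L   ∎
  where
  open ≡-Reasoning
  D I L : Fin n → ℕ
  D = coDegree G
  I = 𝟙 ∘ coIsolated G
  L = 𝟙 ∘ coLeafAt G v

-- v itself has weight at least d but needs only 1, leaving the slack pred d.
NAW⇒coDegree+pred≤ : ∀ {n ℓ} (G : Graph n) → NAW ℓ G → 2 ≤ ℓ → ∀ v →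
                     n + (coDegree G v + pred (coDegree G v)) ≤ 2 * coEdges G + 2
NAW⇒coDegree+pred≤ {n} G naw 2≤ℓ v = begin
  n + (d + pred d)               ≡⟨ +-assoc n d (pred d) ⟨
  n + d + pred d                 ≡⟨ cong (_+ pred d) Σ-lower ⟨
  Σ[< n ] lower + pred d         ≤⟨ Σ-mono-≤-slack n v lower≤weight lower+pred≤weight ⟩
  Σ[< n ] (λ u → weight (coDegree G u) (coAdj G v u))
                                 ≡⟨ Σ-weight G v ⟩
  2 * coEdges G + count n (coIsolated G) + count n (coLeafAt G v)
                                 ≤⟨ +-mono-≤ (+-mono-≤ ≤-refl (count-coIsolated≤1 G naw 2≤ℓ))
                                             (count-coLeafAt≤1 G naw 2≤ℓ v) ⟩
  2 * coEdges G + 1 + 1          ≡⟨ +-assoc (2 * coEdges G) 1 1 ⟩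
  2 * coEdges G + 2              ∎
  where
  open ≤-Reasoning
  d : ℕ
  d = coDegree G v
  lower : Fin n → ℕ
  lower u = suc (𝟙 (coAdj G v u))
  Σ-lower : Σ[< n ] lower ≡ n + d
  Σ-lower = trans (Σ-distrib-+ n (λ _ → 1) (𝟙 ∘ coAdj G v)) (cong (_+ d) (Σ-one n))
  lower≤weight : ∀ u → lower u ≤ weight (coDegree G u) (coAdj G v u)
  lower≤weight u = suc-𝟙≤weight (coDegree G u) (coAdj G v u)
    (subst (λ b → 𝟙 b ≤ coDegree G u) (coAdj-sym G u v) (≤-Σ n (𝟙 ∘ coAdj G u) v))
  lower+pred≤weight : lower v + pred d ≤ weight d (coAdj G v v)
  lower+pred≤weight = subst (λ b → suc (𝟙 b) + pred d ≤ weight d b)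
    (≡.sym (coAdj-irrefl G v)) (suc-pred≤weight d false)

m+pred[m]≤2n+2⇒m≤n+1 : ∀ m n → m + pred m ≤ 2 * n + 2 → m ≤ n + 1
m+pred[m]≤2n+2⇒m≤n+1 zero    n _ = z≤n
m+pred[m]≤2n+2⇒m≤n+1 (suc k) n h = subst (suc k ≤_) (+-comm 1 n) (s≤s (≮⇒≥ n≮k))
  where
  2m+2≡ : ∀ m → 2 * m + 2 ≡ suc m + suc m
  2m+2≡ = solve-∀
  n≮k : ¬ n < k
  n≮k n<k = 1+n≰n (begin
    suc (suc n + suc n)  ≤⟨ s≤s (+-mono-≤ n<k n<k) ⟩
    suc k + k            ≤⟨ h ⟩
    2 * n + 2            ≡⟨ 2m+2≡ n ⟩
    suc n + suc n        ∎)
    where open ≤-Reasoning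

lemma4p11 : (n ℓ t : ℕ) → 2 ∣ n → 2 ≤ ℓ → 1 ≤ t →
    (G : Graph n) → NAW ℓ G →
    2 * coEdges G ≡ n + 2 * t →
    MaxCoDegree≤ G (t + 1)
lemma4p11 n ℓ t _ 2≤ℓ _ G naw 2|E|≡n+2t v =
  m+pred[m]≤2n+2⇒m≤n+1 d t (+-cancelˡ-≤ n _ _ (begin
    n + (d + pred d)   ≤⟨ NAW⇒coDegree+pred≤ G naw 2≤ℓ v ⟩
    2 * coEdges G + 2  ≡⟨ cong (_+ 2) 2|E|≡n+2t ⟩
    n + 2 * t + 2      ≡⟨ +-assoc n (2 * t) 2 ⟩
    n + (2 * t + 2)    ∎))
  where
  open ≤-Reasoning
  d : ℕ
  d = coDegree G v
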